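{- Let $\pi_A:\mathrm{Lit}_A(\tau)\to K$ and $\pi_B:\mathrm{Lit}_B(\tau)\to K$ be model-defining $K$-interpretations that track only positive information. Let $\sigma:B^{\pi_A}_r(\bar a)\to B^{\pi_B}_r(\bar b)$ and $\sigma':B^{\pi_A}_r(\bar a')\to B^{\pi_B}_r(\bar b')$ be two partial isomorphisms between disjoint $r$-neighbourhoods in $\pi_A$ and $\pi_B$. If $d(\bar a,\bar a')>2r+1$ and $d(\bar b,\bar b')>2r+1$, then $\sigma\cup\sigma':B^{\pi_A}_r(\bar a,\bar a')\to B^{\pi_B}_r(\bar b,\bar b')$ is also a partial isomorphism.
   Context: $K$ is a commutative semiring $(K,+,\cdot,0,1)$ with $0\ne1$; $\tau$ a finite relational signature; $A,B$ finite. $\mathrm{Lit}_A(\tau)$ is the set of instantiated literals $R\bar c,\neg R\bar c$ with entries from $A$. Model-defining: for each $R\bar c$ exactly one of $\pi(R\bar c),\pi(\neg R\bar c)$ is $0$; tracks only positive information: $\pi(\neg R\bar c)\in\{0,1\}$. The Gaifman graph of $\pi$ has vertex set the universe, distinct $a,b$ adjacent iff some positive literal $Rc_1\dots c_k$ with nonzero value has $a,b\in\{c_1,\dots,c_k\}$; $d$ is graph distance, $d(\bar a,\bar a')$ the minimum distance between entries of $\bar a$ and $\bar a'$, and $B^\pi_r(\bar a)$ the set of elements at distance $\le r$ from some entry of $\bar a$. A partial isomorphism between $\pi_A$ and $\pi_B$ is a bijection $\sigma:X\to Y$, $X\subseteq A$, $Y\subseteq B$, with $\pi_A(L)=\pi_B(\sigma(L))$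 for every literal $L$ instantiated with elements of $X$ only ($\sigma(L)$ replaces each element $c$ by $\sigma(c)$). -}

module Defs where

open import Level using (Level; _⊔_) renaming (zero to 0ℓ)
open import Algebra.Bundles using (CommutativeSemiring)
open import Data.Nat using (ℕ; zero; suc; _+_; _*_; _≤_; _<_)
open import Data.Fin using (Fin)
open import Data.Vec.Functional using (Vector; _++_)
open import Data.Product using (Σ; ∃; ∃-syntax; _×_; _,_)
open import Data.Sum using (_⊎_)
open import Relation.Nullary using (¬_)
open import Relation.Binary.PropositionalEquality using (_≡_; _≢_)

record Signature : Set where
  field
    nRel : ℕ
    arity : Fin nRel → ℕ
open Signature public

data Lit (τ : Signature) (n : ℕ) : Set where
  pos : (R : Fin (nRel τ)) → Vector (Fin n) (arity τ R) → Lit τ n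
  neg : (R : Fin (nRel τ)) → Vector (Fin n) (arity τ R) → Lit τ n

-- A partial map given by its graph σ ⊆ A × B; L ~ L' iff L' = σ(L)
-- (same relation symbol, same polarity, entries related by σ).
data LitRel {τ : Signature} {n m : ℕ} (σ : Fin n → Fin m → Set) : Lit τ n → Lit τ m → Set where
  pos~ : ∀ R (c : Vector (Fin n) (arity τ R)) (d : Vector (Fin m) (arity τ R)) →
         (∀ i → σ (c i) (d i)) → LitRel σ (pos R c) (pos R d)
  neg~ : ∀ R (c : Vector (Fin n) (arity τ R)) (d : Vector (Fin m) (arity τ R)) →
         (∀ i → σ (c i) (d i)) → LitRel σ (neg R c) (neg R d)

module _ {c ℓ : Level} (K : CommutativeSemiring c ℓ) (τ : Signature) where
  open CommutativeSemiring K using (Carrier; _≈_; 0#; 1#)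

  Interp : ℕ → Set c
  Interp n = Lit τ n → Carrier

  ModelDefining : {n : ℕ} → Interp n → Set ℓ
  ModelDefining {n} π = ∀ R (c : Vector (Fin n) (arity τ R)) →
    ((π (pos R c) ≈ 0#) × ¬ (π (neg R c) ≈ 0#)) ⊎ (¬ (π (pos R c) ≈ 0#) × (π (neg R c) ≈ 0#))

  TracksOnlyPositive : {n : ℕ} → Interp n → Set ℓ
  TracksOnlyPositive {n} π = ∀ R (c : Vector (Fin n) (arity τ R)) →
    (π (neg R c) ≈ 0#) ⊎ (π (neg R c) ≈ 1#)

  Adj : {n : ℕ} → Interp n → Fin n → Fin n → Set ℓ
  Adj {n} π a b = (a ≢ b) × ∃[ R ] ∃[ c ] (¬ (π (pos R c) ≈ 0#) ×
                   (∃[ i ] c i ≡ a) × (∃[ j ] c j ≡ b))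

  data Walk {n : ℕ} (π : Interp n) : Fin n → Fin n → ℕ → Set ℓ where
    here : ∀ a → Walk π a a zero
    step : ∀ {a b e k} → Adj π a b → Walk π b e k → Walk π a e (suc k)

  DistLe : {n : ℕ} → Interp n → Fin n → Fin n → ℕ → Set ℓ
  DistLe π x y k = ∃[ j ] (j ≤ k × Walk π x y j)

  Ball : {n m : ℕ} → Interp n → ℕ → Vector (Fin n) m → Fin n → Set ℓ
  Ball π r ā x = ∃[ i ] DistLe π (ā i) x r

  -- d(ā, ā') > k  (minimum over entries; distance ∞ if disconnected)
  DistGt : {n m m' : ℕ} → Interp n → Vector (Fin n) m → Vector (Fin n) m' → ℕ → Set ℓ
  DistGt π ā ā' k = ∀ i j → ¬ DistLe π (ā i) (ā' j) k

  record PartialIso {nA nB : ℕ} (πA : Interp nA) (πB : Interp nB)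
         (X : Fin nA → Set ℓ) (Y : Fin nB → Set ℓ) (σ : Fin nA → Fin nB → Set) : Set (c ⊔ ℓ) where
    field
      total      : ∀ a → X a → ∃[ b ] σ a b
      inDomCod   : ∀ a b → σ a b → X a × Y b
      functional : ∀ {a b b'} → σ a b → σ a b' → b ≡ b'
      injective  : ∀ {a a' b} → σ a b → σ a' b → a ≡ a'
      surjective : ∀ b → Y b → ∃[ a ] σ a b
      preserves  : ∀ (L : Lit τ nA) (L' : Lit τ nB) → LitRel σ L L' → πA L ≈ πB L'

_∪ʳ_ : {n m : ℕ} → (Fin n → Fin m → Set) → (Fin n → Fin m → Set) → Fin n → Fin m → Set
(σ ∪ʳ σ') a b = σ a b ⊎ σ' a b

-- Balls of radius r around tuples at distance more than 2r + 1 are disjoint, and no edge of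
-- the Gaifman graph joins them.  Hence σ ∪ σ' is again a bijection, and every literal that
-- mixes entries of both balls has a positive version of value 0: otherwise its entries would
-- be adjacent.  As the interpretations are model-defining and track only positive
-- information, such a literal has positive value 0 and negative value 1 on both sides, so
-- σ ∪ σ' preserves it.
module Submission where

open import Defs
open import Algebra.Bundles using (CommutativeSemiring)
open import Data.Nat using (ℕ; _+_; _*_; zero; suc; _≤_)
open import Data.Nat.Properties using (+-mono-≤; +-monoʳ-≤; +-suc; +-comm; +-identityʳ; ≤-trans; ≤-reflexive; n≤1+n)
open import Data.Fin using (Fin; splitAt; _↑ˡ_; _↑ʳ_)
open import Data.Fin.Properties using (∀-cons)
open import Data.Vec.Functional using (Vector; _++_)
open import Data.Vec.Functional.Properties using (lookup-++ˡ; lookup-++ʳ)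
open import Data.Product using (∃; ∃-syntax; _×_; _,_; proj₁; proj₂)
open import Data.Sum using (_⊎_; inj₁; inj₂; swap)
open import Data.Empty using (⊥-elim)
open import Relation.Nullary using (¬_)
open import Relation.Unary using (Pred; _∪_; _≐_) renaming (_⊥_ to Disjoint)
open import Relation.Binary.PropositionalEquality using (_≡_; _≢_; refl; sym; cong; subst; module ≡-Reasoning)

∀⊎∃ : ∀ {p q} {k : ℕ} {P : Pred (Fin k) p} {Q : Pred (Fin k) q} →
      (∀ i → P i ⊎ Q i) → (∀ i → P i) ⊎ ∃ Q
∀⊎∃ {k = zero}  f = inj₁ λ ()
∀⊎∃ {k = suc k} f with f Fin.zero | ∀⊎∃ (λ i → f (Fin.suc i))
... | inj₂ q | _            = inj₂ (Fin.zero , q)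
... | inj₁ p | inj₂ (i , q) = inj₂ (Fin.suc i , q)
... | inj₁ p | inj₁ ps      = inj₁ (∀-cons p ps)

∀⊎∀⊎mixed : ∀ {p q} {k : ℕ} {P : Pred (Fin k) p} {Q : Pred (Fin k) q} →
            (∀ i → P i ⊎ Q i) → (∀ i → P i) ⊎ (∀ i → Q i) ⊎ (∃ P × ∃ Q)
∀⊎∀⊎mixed f with ∀⊎∃ f
... | inj₁ ps = inj₁ ps
... | inj₂ q with ∀⊎∃ (λ i → swap (f i))
...   | inj₁ qs = inj₂ (inj₁ qs)
...   | inj₂ p  = inj₂ (inj₂ (p , q))

r+1+r≡2r+1 : ∀ r → r + suc r ≡ 2 * r + 1
r+1+r≡2r+1 r = begin
  r + suc r    ≡⟨ +-suc r r ⟩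
  suc (r + r)  ≡⟨ cong (λ t → suc (r + t)) (sym (+-identityʳ r)) ⟩
  suc (2 * r)  ≡⟨ +-comm 1 (2 * r) ⟩
  2 * r + 1    ∎
  where open ≡-Reasoning

module _ {c ℓ} (K : CommutativeSemiring c ℓ) (τ : Signature) where
  open CommutativeSemiring K using (_≈_; 0#; 1#) renaming (sym to ≈-sym; trans to ≈-trans)

  module _ {n : ℕ} {π : Interp K τ n} where

    Adj-sym : ∀ {x y} → Adj K τ π x y → Adj K τ π y x
    Adj-sym (x≢y , R , c , nz , x∈c , y∈c) = (λ y≡x → x≢y (sym y≡x)) , R , c , nz , y∈c , x∈c

    Walk-++ : ∀ {x y z j k} → Walk K τ π x y j → Walk K τ π y z k → Walk K τ π x z (j + k)
    Walk-++ (here _)   w′ = w′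
    Walk-++ (step e w) w′ = step e (Walk-++ w w′)

    Walk-snoc : ∀ {x y z j} → Walk K τ π x y j → Adj K τ π y z → Walk K τ π x z (suc j)
    Walk-snoc (here _)   e′ = step e′ (here _)
    Walk-snoc (step e w) e′ = step e (Walk-snoc w e′)

    Walk-reverse : ∀ {x y j} → Walk K τ π x y j → Walk K τ π y x j
    Walk-reverse (here _)   = here _
    Walk-reverse (step e w) = Walk-snoc (Walk-reverse w) (Adj-sym e)

    DistLe-sym : ∀ {x y k} → DistLe K τ π x y k → DistLe K τ π y x k
    DistLe-sym (j , j≤k , w) = j , j≤k , Walk-reverse w

    DistLe-trans : ∀ {x y z k l} → DistLe K τ π x y k → DistLe K τ π y z l → DistLe K τ π x z (k + l)
    DistLe-trans (i , i≤k , w) (j , j≤l , w′) = i + j , +-mono-≤ i≤k j≤l , Walk-++ w w′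

    Adj⇒DistLe : ∀ {x y} → Adj K τ π x y → DistLe K τ π x y 1
    Adj⇒DistLe e = 1 , ≤-reflexive refl , step e (here _)

    DistGt-antimono : ∀ {m m′} {a : Vector (Fin n) m} {a′ : Vector (Fin n) m′} {j k} →
                      j ≤ k → DistGt K τ π a a′ k → DistGt K τ π a a′ j
    DistGt-antimono j≤k far i i′ (l , l≤j , w) = far i i′ (l , ≤-trans l≤j j≤k , w)

    Separated : Pred (Fin n) ℓ → Pred (Fin n) ℓ → Set ℓ
    Separated X X′ = Disjoint X X′ × (∀ {x y} → X x → X′ y → ¬ Adj K τ π x y)

    module _ {m m′} {a : Vector (Fin n) m} {a′ : Vector (Fin n) m′} where

      Ball-disjoint : ∀ {r s} → DistGt K τ π a a′ (r + s) → Disjoint (Ball K τ π r a) (Ball K τ π s a′)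
      Ball-disjoint far ((i , d) , (i′ , d′)) = far i i′ (DistLe-trans d (DistLe-sym d′))

      Ball-nonadjacent : ∀ {r s x y} → DistGt K τ π a a′ (r + suc s) →
                         Ball K τ π r a x → Ball K τ π s a′ y → ¬ Adj K τ π x y
      Ball-nonadjacent far (i , d) (i′ , d′) e =
        far i i′ (DistLe-trans d (DistLe-trans (Adj⇒DistLe e) (DistLe-sym d′)))

      far⇒Ball-separated : ∀ {r} → DistGt K τ π a a′ (2 * r + 1) →
                           Separated (Ball K τ π r a) (Ball K τ π r a′)
      far⇒Ball-separated {r} far =
        Ball-disjoint (DistGt-antimono (≤-trans (+-monoʳ-≤ r (n≤1+n r)) (≤-reflexive (r+1+r≡2r+1 r))) far) ,
        Ball-nonadjacent (DistGt-antimono (≤-reflexive (r+1+r≡2r+1 r)) far)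

      Ball-++ : ∀ {r} → Ball K τ π r a ∪ Ball K τ π r a′ ≐ Ball K τ π r (a ++ a′)
      Ball-++ {r} = ∪⊆++ , ++⊆∪
        where
        ∪⊆++ : ∀ {x} → (Ball K τ π r a ∪ Ball K τ π r a′) x → Ball K τ π r (a ++ a′) x
        ∪⊆++ {x} (inj₁ (i , d)) = i ↑ˡ m′ , subst (λ t → DistLe K τ π t x r) (sym (lookup-++ˡ a a′ i)) d
        ∪⊆++ {x} (inj₂ (i , d)) = m ↑ʳ i , subst (λ t → DistLe K τ π t x r) (sym (lookup-++ʳ a a′ i)) d

        ++⊆∪ : ∀ {x} → Ball K τ π r (a ++ a′) x → (Ball K τ π r a ∪ Ball K τ π r a′) x
        ++⊆∪ (i , d) with splitAt m i
        ... | inj₁ j = inj₁ (j , d)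
        ... | inj₂ j = inj₂ (j , d)

    Absent : (R : Fin (nRel τ)) → Vector (Fin n) (arity τ R) → Set ℓ
    Absent R c = π (pos R c) ≈ 0# × π (neg R c) ≈ 1#

    mixed-literal-absent : ModelDefining K τ π → TracksOnlyPositive K τ π →
                           ∀ {X X′ : Pred (Fin n) ℓ} → Separated X X′ →
                           ∀ R c {i j} → X (c i) → X′ (c j) → Absent R c
    mixed-literal-absent md tp {X′ = X′} (disjoint , nonadjacent) R c {i} {j} x∈X y∈X′ with md R c
    ... | inj₂ (pos≉0 , _) = ⊥-elim (nonadjacent x∈X y∈X′ (x≢y , R , c , pos≉0 , (i , refl) , (j , refl)))
      where
      x≢y : c i ≢ c j
      x≢y x≡y = disjoint (x∈X , subst X′ (sym x≡y) y∈X′)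
    ... | inj₁ (pos≈0 , neg≉0) with tp R c
    ...   | inj₁ neg≈0 = ⊥-elim (neg≉0 neg≈0)
    ...   | inj₂ neg≈1 = pos≈0 , neg≈1

  module _ {nA nB : ℕ} {πA : Interp K τ nA} {πB : Interp K τ nB} {σ : Fin nA → Fin nB → Set} where

    PartialIso-resp : ∀ {X X₂ Y Y₂} → X ≐ X₂ → Y ≐ Y₂ →
                      PartialIso K τ πA πB X Y σ → PartialIso K τ πA πB X₂ Y₂ σ
    PartialIso-resp (X⊆X₂ , X₂⊆X) (Y⊆Y₂ , Y₂⊆Y) iso = record
      { total      = λ x x∈X₂ → total x (X₂⊆X x∈X₂)
      ; inDomCod   = λ x y s → let (x∈X , y∈Y) = inDomCod x y s in X⊆X₂ x∈X , Y⊆Y₂ y∈Y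
      ; functional = functional
      ; injective  = injective
      ; surjective = λ y y∈Y₂ → surjective y (Y₂⊆Y y∈Y₂)
      ; preserves  = preserves
      }
      where open PartialIso iso

  module _ {nA nB : ℕ} {πA : Interp K τ nA} {πB : Interp K τ nB}
           (mdA : ModelDefining K τ πA) (tpA : TracksOnlyPositive K τ πA)
           (mdB : ModelDefining K τ πB) (tpB : TracksOnlyPositive K τ πB)
           {X X′ : Pred (Fin nA) ℓ} {Y Y′ : Pred (Fin nB) ℓ} {σ σ′ : Fin nA → Fin nB → Set}
           (sepA : Separated {π = πA} X X′) (sepB : Separated {π = πB} Y Y′)
           (iso : PartialIso K τ πA πB X Y σ) (iso′ : PartialIso K τ πA πB X′ Y′ σ′) where

    private
      module I = PartialIso iso
      module I′ = PartialIso iso′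

    ∪-total : ∀ x → (X ∪ X′) x → ∃[ y ] (σ ∪ʳ σ′) x y
    ∪-total x (inj₁ x∈X)  = let (y , s) = I.total x x∈X in y , inj₁ s
    ∪-total x (inj₂ x∈X′) = let (y , s) = I′.total x x∈X′ in y , inj₂ s

    ∪-inDomCod : ∀ x y → (σ ∪ʳ σ′) x y → (X ∪ X′) x × (Y ∪ Y′) y
    ∪-inDomCod x y (inj₁ s) = let (x∈X , y∈Y) = I.inDomCod x y s in inj₁ x∈X , inj₁ y∈Y
    ∪-inDomCod x y (inj₂ s) = let (x∈X , y∈Y) = I′.inDomCod x y s in inj₂ x∈X , inj₂ y∈Y

    ∪-functional : ∀ {x y y′} → (σ ∪ʳ σ′) x y → (σ ∪ʳ σ′) x y′ → y ≡ y′
    ∪-functional (inj₁ s) (inj₁ t) = I.functional s t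
    ∪-functional (inj₂ s) (inj₂ t) = I′.functional s t
    ∪-functional (inj₁ s) (inj₂ t) = ⊥-elim (proj₁ sepA (proj₁ (I.inDomCod _ _ s) , proj₁ (I′.inDomCod _ _ t)))
    ∪-functional (inj₂ s) (inj₁ t) = ⊥-elim (proj₁ sepA (proj₁ (I.inDomCod _ _ t) , proj₁ (I′.inDomCod _ _ s)))

    ∪-injective : ∀ {x x′ y} → (σ ∪ʳ σ′) x y → (σ ∪ʳ σ′) x′ y → x ≡ x′
    ∪-injective (inj₁ s) (inj₁ t) = I.injective s t
    ∪-injective (inj₂ s) (inj₂ t) = I′.injective s t
    ∪-injective (inj₁ s) (inj₂ t) = ⊥-elim (proj₁ sepB (proj₂ (I.inDomCod _ _ s) , proj₂ (I′.inDomCod _ _ t)))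
    ∪-injective (inj₂ s) (inj₁ t) = ⊥-elim (proj₁ sepB (proj₂ (I.inDomCod _ _ t) , proj₂ (I′.inDomCod _ _ s)))

    ∪-surjective : ∀ y → (Y ∪ Y′) y → ∃[ x ] (σ ∪ʳ σ′) x y
    ∪-surjective y (inj₁ y∈Y)  = let (x , s) = I.surjective y y∈Y in x , inj₁ s
    ∪-surjective y (inj₂ y∈Y′) = let (x , s) = I′.surjective y y∈Y′ in x , inj₂ s

    ∪-literal : ∀ R c d → (∀ i → (σ ∪ʳ σ′) (c i) (d i)) →
                (∀ i → σ (c i) (d i)) ⊎ (∀ i → σ′ (c i) (d i)) ⊎ (Absent {π = πA} R c × Absent {π = πB} R d)
    ∪-literal R c d f with ∀⊎∀⊎mixed f
    ... | inj₁ f₁ = inj₁ f₁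
    ... | inj₂ (inj₁ f₂) = inj₂ (inj₁ f₂)
    ... | inj₂ (inj₂ ((i , s) , (j , t))) =
      let (ci∈X , di∈Y) = I.inDomCod _ _ s
          (cj∈X′ , dj∈Y′) = I′.inDomCod _ _ t
      in inj₂ (inj₂ (mixed-literal-absent {π = πA} mdA tpA sepA R c ci∈X cj∈X′ ,
                     mixed-literal-absent {π = πB} mdB tpB sepB R d di∈Y dj∈Y′))

    ∪-preserves : ∀ L L′ → LitRel (σ ∪ʳ σ′) L L′ → πA L ≈ πB L′
    ∪-preserves _ _ (pos~ R c d f) with ∪-literal R c d f
    ... | inj₁ f₁ = I.preserves _ _ (pos~ R c d f₁)
    ... | inj₂ (inj₁ f₂) = I′.preserves _ _ (pos~ R c d f₂)
    ... | inj₂ (inj₂ ((posA≈0 , _) , (posB≈0 , _))) = ≈-trans posA≈0 (≈-sym posB≈0)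
    ∪-preserves _ _ (neg~ R c d f) with ∪-literal R c d f
    ... | inj₁ f₁ = I.preserves _ _ (neg~ R c d f₁)
    ... | inj₂ (inj₁ f₂) = I′.preserves _ _ (neg~ R c d f₂)
    ... | inj₂ (inj₂ ((_ , negA≈1) , (_ , negB≈1))) = ≈-trans negA≈1 (≈-sym negB≈1)

    PartialIso-∪ : PartialIso K τ πA πB (X ∪ X′) (Y ∪ Y′) (σ ∪ʳ σ′)
    PartialIso-∪ = record
      { total      = ∪-total
      ; inDomCod   = ∪-inDomCod
      ; functional = ∪-functional
      ; injective  = ∪-injective
      ; surjective = ∪-surjective
      ; preserves  = ∪-preserves
      }

lemma7 : ∀ {c ℓ} (K : CommutativeSemiring c ℓ) (τ : Signature) →
    ¬ (CommutativeSemiring._≈_ K (CommutativeSemiring.0# K) (CommutativeSemiring.1# K)) →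
    ∀ {nA nB : ℕ} (πA : Interp K τ nA) (πB : Interp K τ nB) →
    ModelDefining K τ πA → TracksOnlyPositive K τ πA →
    ModelDefining K τ πB → TracksOnlyPositive K τ πB →
    ∀ (r : ℕ) {k k' : ℕ} (a : Vector (Fin nA) k) (b : Vector (Fin nB) k)
      (a' : Vector (Fin nA) k') (b' : Vector (Fin nB) k')
      (σ σ' : Fin nA → Fin nB → Set) →
    PartialIso K τ πA πB (Ball K τ πA r a) (Ball K τ πB r b) σ →
    PartialIso K τ πA πB (Ball K τ πA r a') (Ball K τ πB r b') σ' →
    DistGt K τ πA a a' (2 * r + 1) →
    DistGt K τ πB b b' (2 * r + 1) →
    PartialIso K τ πA πB (Ball K τ πA r (a ++ a')) (Ball K τ πB r (b ++ b')) (σ ∪ʳ σ')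
lemma7 K τ _ πA πB mdA tpA mdB tpB r a b a′ b′ σ σ′ iso iso′ farA farB =
  PartialIso-resp K τ (Ball-++ K τ) (Ball-++ K τ)
    (PartialIso-∪ K τ mdA tpA mdB tpB (far⇒Ball-separated K τ farA) (far⇒Ball-separated K τ farB) iso iso′)
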